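{- Let $G=(V,E)$ be a finite graph such that (1) $G$ is neither a forest nor a circuit; (2) every cycle of $G$ (every element of $\mathrm{Z}_1(G;\mathbb{F}_2)$) is a symmetric difference of edge sets of Hamilton circuits of $G$; (3) $G$ contains a vertex of degree $2$. Then for every vertex $v$ of $G$ with $\deg(v)=2$, the graph $G-v$ obtained by deleting $v$ is bipartite.
   Context: A "circuit" is a $2$-regular connected graph; a Hamilton circuit of $G$ is a circuit subgraph containing all vertices of $G$. $\mathrm{Z}_1(G;\mathbb{F}_2)$ is the cycle space of $G$ over $\mathbb{F}_2$: the set of edge sets in which every vertex has even degree, with symmetric difference as addition; its elements are called cycles. "Every cycle is a symmetric difference of Hamilton circuits" means $\mathrm{Z}_1(G;\mathbb{F}_2)$ equals the $\mathbb{F}_2$-span of the edge sets of the Hamilton circuits of $G$. -}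

module Defs where

open import Data.Nat using (ℕ; zero; suc; _+_)
open import Data.Nat.Divisibility using (_∣_)
open import Data.Fin using (Fin; zero; suc)
open import Data.Bool using (Bool; true; false; _xor_; if_then_else_)
open import Data.List using (List; []; _∷_; foldr)
open import Data.List.Relation.Unary.All using (All)
open import Data.Product using (Σ; ∃; _×_; _,_)
open import Relation.Binary.PropositionalEquality using (_≡_; _≢_)
open import Relation.Nullary using (¬_)

record Graph : Set where
  field
    n      : ℕ
    Adj    : Fin n → Fin n → Bool
    sym    : ∀ i j → Adj i j ≡ Adj j i
    irrefl : ∀ i → Adj i i ≡ false
open Graph public

countTrue : ∀ {m} → (Fin m → Bool) → ℕ
countTrue {zero}  f = 0
countTrue {suc m} f = (if f zero then 1 else 0) + countTrue (λ i → f (suc i))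

-- An edge set on vertex set Fin m, as a (to be symmetric) Bool relation.
EdgeSet : ℕ → Set
EdgeSet m = Fin m → Fin m → Bool

IsEdgeSetOf : (G : Graph) → EdgeSet (n G) → Set
IsEdgeSetOf G S = (∀ i j → S i j ≡ S j i) × (∀ i j → S i j ≡ true → Adj G i j ≡ true)

degIn : ∀ {m} → EdgeSet m → Fin m → ℕ
degIn S v = countTrue (S v)

deg : (G : Graph) → Fin (n G) → ℕ
deg G v = degIn (Adj G) v

data Walk {m : ℕ} (S : EdgeSet m) : Fin m → Fin m → Set where
  here : ∀ {u} → Walk S u u
  step : ∀ {u w v} → S u w ≡ true → Walk S w v → Walk S u v

-- Circuit subgraph of G (2-regular connected subgraph), given by its edge set C:
-- nonempty, every vertex has C-degree 0 or 2, and any two vertices touched by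
-- C are joined by a walk in C.
IsCircuitIn : (G : Graph) → EdgeSet (n G) → Set
IsCircuitIn G C =
  IsEdgeSetOf G C ×
  (∃ λ i → ∃ λ j → C i j ≡ true) ×
  (∀ v → (degIn C v ≡ 0) Data.Sum.⊎ (degIn C v ≡ 2)) ×
  (∀ u v → degIn C u ≢ 0 → degIn C v ≢ 0 → Walk C u v)
  where import Data.Sum

IsHamiltonCircuit : (G : Graph) → EdgeSet (n G) → Set
IsHamiltonCircuit G H =
  IsEdgeSetOf G H ×
  (∀ v → degIn H v ≡ 2) ×
  (∀ u v → Walk H u v)

IsForest : Graph → Set
IsForest G = ¬ (∃ λ C → IsCircuitIn G C)

IsCircuit : Graph → Set
IsCircuit G = (∀ v → deg G v ≡ 2) × (∀ u v → Walk (Adj G) u v) × Fin (n G)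

-- Elements of the cycle space Z₁(G; F₂): edge sets with all degrees even.
IsCycle : (G : Graph) → EdgeSet (n G) → Set
IsCycle G S = IsEdgeSetOf G S × (∀ v → 2 ∣ degIn S v)

emptyES : ∀ {m} → EdgeSet m
emptyES i j = false

symDiff : ∀ {m} → EdgeSet m → EdgeSet m → EdgeSet m
symDiff S T i j = S i j xor T i j

sumES : ∀ {m} → List (EdgeSet m) → EdgeSet m
sumES = foldr symDiff emptyES

InHamiltonSpan : (G : Graph) → EdgeSet (n G) → Set
InHamiltonSpan G S =
  Σ (List (EdgeSet (n G))) λ Hs →
    All (IsHamiltonCircuit G) Hs × (∀ i j → sumES Hs i j ≡ S i j)

CyclesSpannedByHamiltonCircuits : Graph → Set
CyclesSpannedByHamiltonCircuits G = ∀ S → IsCycle G S → InHamiltonSpan G S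

-- G - v is bipartite: a 2-colouring of V(G) ∖ {v} proper on edges avoiding v.
DeleteVertexBipartite : (G : Graph) → Fin (n G) → Set
DeleteVertexBipartite G v =
  Σ (Fin (n G) → Bool) λ c →
    ∀ u w → u ≢ v → w ≢ v → Adj G u w ≡ true → c u ≢ c w

-- Let v have degree 2 and let a be one of its two neighbours. Over F₂ the
-- functional ω(S) = |S| + n·[va ∈ S] is additive. It vanishes on every
-- Hamilton circuit H, since |H| = n and H must use both edges at v, so by
-- hypothesis it vanishes on every cycle. Colour each vertex u by ω of a walk
-- from v to u inside some Hamilton circuit (one exists because G is not a
-- forest). An edge uw of G − v closes these two walks into a cycle on which
-- ω vanishes, while ω(uw) = 1, so u and w get different colours.
module Submission where

open import Defs renaming (sym to Adj-sym)
open import Algebra.Bundles using (CommutativeRing)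
open import Data.Bool using (Bool; true; false; not; _∧_; _∨_; _xor_; if_then_else_)
open import Data.Bool.Properties as Bool
  using (xor-∧-commutativeRing; not-involutive; not-distribˡ-xor; xor-same; xor-comm
        ; ∧-comm; ∨-comm; ∨-identityʳ; ∧-distribʳ-xor)
open import Data.Empty using (⊥-elim)
open import Data.Fin using (Fin; zero; suc)
open import Data.Fin.Properties using (_≟_; all?)
open import Data.Fin.Subset.Properties using (anySubset?)
open import Data.List using ([]; _∷_)
open import Data.List.Relation.Unary.All using (All; []; _∷_)
open import Data.Nat using (ℕ; zero; suc; _+_; _*_; _≤_; _<_; z≤n; s≤s)
open import Data.Nat.Divisibility using (_∣_; divides)
open import Data.Nat.Properties using (+-0-commutativeMonoid; *-comm; *-cancelˡ-≡; ≤-trans; n≤1+n; <-irrefl)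
open import Data.Nat.Tactic.RingSolver using (solve-∀)
open import Data.Product using (∃; _×_; _,_)
open import Data.Sum using (_⊎_; inj₁; inj₂)
open import Data.Vec using (lookup; tabulate)
open import Data.Vec.Properties using (lookup∘tabulate)
open import Function using (_∘_)
open import Relation.Binary.PropositionalEquality
  using (_≡_; _≢_; refl; sym; trans; cong; cong₂; module ≡-Reasoning)
open import Relation.Nullary using (¬_; Dec; yes; no; does; contradiction)
open import Relation.Nullary.Decidable using (dec-false; map′; ¬?; _→-dec_; decidable-stable)

open import Algebra.Properties.CommutativeMonoid.Sum +-0-commutativeMonoid
  using (sum-syntax; sum-cong-≗; ∑-distrib-+)
open import Algebra.Properties.CommutativeSemigroup
  (CommutativeRing.+-commutativeSemigroup xor-∧-commutativeRing)
  using () renaming (interchange to xor-interchange)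

open ≡-Reasoning

xor-cancel-middle : ∀ a b c → (a xor b) xor (b xor c) ≡ a xor c
xor-cancel-middle true  true  c = refl
xor-cancel-middle true  false c = refl
xor-cancel-middle false true  c = not-involutive c
xor-cancel-middle false false c = refl

xor-true-xor : ∀ a → a xor (true xor a) ≡ true
xor-true-xor true  = refl
xor-true-xor false = refl

indicator : Bool → ℕ
indicator b = if b then 1 else 0

odd : ℕ → Bool
odd zero    = false
odd (suc m) = not (odd m)

odd-+ : ∀ k m → odd (k + m) ≡ odd k xor odd m
odd-+ zero    m = refl
odd-+ (suc k) m = trans (cong not (odd-+ k m)) (not-distribˡ-xor (odd k) (odd m))

odd-indicator : ∀ b → odd (indicator b) ≡ b
odd-indicator true  = refl
odd-indicator false = refl

even-if-not-odd : ∀ m → odd m ≡ false → 2 ∣ m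
even-if-not-odd zero          _ = divides 0 refl
even-if-not-odd (suc (suc m)) p with even-if-not-odd m (trans (sym (not-involutive (odd m))) p)
... | divides q m≡q*2 = divides (suc q) (cong (λ k → suc (suc k)) m≡q*2)

∑-const : ∀ m k → ∑[ i < m ] k ≡ m * k
∑-const zero    k = refl
∑-const (suc m) k = cong (k +_) (∑-const m k)

countTrue-cong : ∀ {m} {f g : Fin m → Bool} → (∀ i → f i ≡ g i) → countTrue f ≡ countTrue g
countTrue-cong {zero}  f≗g = refl
countTrue-cong {suc m} f≗g = cong₂ _+_ (cong indicator (f≗g zero)) (countTrue-cong (f≗g ∘ suc))

countTrue-false : ∀ {m} → countTrue {m} (λ _ → false) ≡ 0
countTrue-false {zero}  = refl
countTrue-false {suc m} = countTrue-false {m}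

countTrue≡∑ : ∀ {m} (f : Fin m → Bool) → countTrue f ≡ ∑[ i < m ] indicator (f i)
countTrue≡∑ {zero}  f = refl
countTrue≡∑ {suc m} f = cong (indicator (f zero) +_) (countTrue≡∑ (f ∘ suc))

odd-countTrue-suc : ∀ {m} (f : Fin (suc m) → Bool) → odd (countTrue f) ≡ f zero xor odd (countTrue (f ∘ suc))
odd-countTrue-suc f = trans (odd-+ (indicator (f zero)) _) (cong (_xor odd (countTrue (f ∘ suc))) (odd-indicator (f zero)))

odd-countTrue-xor : ∀ {m} (f g : Fin m → Bool) →
                    odd (countTrue (λ i → f i xor g i)) ≡ odd (countTrue f) xor odd (countTrue g)
odd-countTrue-xor {zero}  f g = refl
odd-countTrue-xor {suc m} f g = begin
  odd (countTrue (λ i → f i xor g i))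
    ≡⟨ odd-countTrue-suc (λ i → f i xor g i) ⟩
  (f zero xor g zero) xor odd (countTrue (λ i → f (suc i) xor g (suc i)))
    ≡⟨ cong ((f zero xor g zero) xor_) (odd-countTrue-xor (f ∘ suc) (g ∘ suc)) ⟩
  (f zero xor g zero) xor (odd (countTrue (f ∘ suc)) xor odd (countTrue (g ∘ suc)))
    ≡⟨ xor-interchange (f zero) (g zero) _ _ ⟩
  (f zero xor odd (countTrue (f ∘ suc))) xor (g zero xor odd (countTrue (g ∘ suc)))
    ≡⟨ sym (cong₂ _xor_ (odd-countTrue-suc f) (odd-countTrue-suc g)) ⟩
  odd (countTrue f) xor odd (countTrue g) ∎

countTrue-nonzero : ∀ {m} (f : Fin m → Bool) → countTrue f ≢ 0 → ∃ λ i → f i ≡ true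
countTrue-nonzero {zero}  f count≢0 = ⊥-elim (count≢0 refl)
countTrue-nonzero {suc m} f count≢0 with f zero in f0
... | true  = zero , f0
... | false with countTrue-nonzero (f ∘ suc) count≢0
...   | i , fi = suc i , fi

countTrue-mono : ∀ {m} {f g : Fin m → Bool} → (∀ i → f i ≡ true → g i ≡ true) → countTrue f ≤ countTrue g
countTrue-mono {zero}          f⊆g = z≤n
countTrue-mono {suc m} {f} {g} f⊆g with f zero in f0 | g zero in g0
... | true  | true  = s≤s (countTrue-mono (f⊆g ∘ suc))
... | true  | false with () ← trans (sym (f⊆g zero f0)) g0
... | false | true  = ≤-trans (countTrue-mono (f⊆g ∘ suc)) (n≤1+n _)
... | false | false = countTrue-mono (f⊆g ∘ suc)

countTrue-strict : ∀ {m} {f g : Fin m → Bool} → (∀ i → f i ≡ true → g i ≡ true) →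
                   ∀ i → g i ≡ true → f i ≡ false → countTrue f < countTrue g
countTrue-strict {suc m} {f} {g} f⊆g zero gi fi rewrite gi | fi = s≤s (countTrue-mono (f⊆g ∘ suc))
countTrue-strict {suc m} {f} {g} f⊆g (suc i) gi fi with f zero in f0 | g zero in g0
... | true  | true  = s≤s (countTrue-strict (f⊆g ∘ suc) i gi fi)
... | true  | false with () ← trans (sym (f⊆g zero f0)) g0
... | false | true  = ≤-trans (countTrue-strict (f⊆g ∘ suc) i gi fi) (n≤1+n _)
... | false | false = countTrue-strict (f⊆g ∘ suc) i gi fi

countTrue-≡⇒⊇ : ∀ {m} {f g : Fin m → Bool} → (∀ i → f i ≡ true → g i ≡ true) →
                countTrue f ≡ countTrue g → ∀ i → g i ≡ true → f i ≡ true
countTrue-≡⇒⊇ {f = f} f⊆g same i gi with f i in fi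
... | true  = refl
... | false = ⊥-elim (<-irrefl same (countTrue-strict f⊆g i gi fi))

countTrue-≟ : ∀ {m} (y : Fin m) → countTrue (λ j → does (j ≟ y)) ≡ 1
countTrue-≟ {suc m} zero    = cong suc (countTrue-false {m})
countTrue-≟ {suc m} (suc y) = countTrue-≟ y

-- Counts the pairs i < j with S i j.
edgeCount : ∀ {m} → EdgeSet m → ℕ
edgeCount {zero}  S = 0
edgeCount {suc m} S = countTrue (λ j → S zero (suc j)) + edgeCount (λ i j → S (suc i) (suc j))

edgeCount-cong : ∀ {m} {S T : EdgeSet m} → (∀ i j → S i j ≡ T i j) → edgeCount S ≡ edgeCount T
edgeCount-cong {zero}  S≗T = refl
edgeCount-cong {suc m} S≗T =
  cong₂ _+_ (countTrue-cong (S≗T zero ∘ suc)) (edgeCount-cong (λ i j → S≗T (suc i) (suc j)))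

edgeCount-empty : ∀ {m} → edgeCount (emptyES {m}) ≡ 0
edgeCount-empty {zero}  = refl
edgeCount-empty {suc m} = cong₂ _+_ (countTrue-false {m}) (edgeCount-empty {m})

odd-edgeCount-symDiff : ∀ {m} (S T : EdgeSet m) →
                        odd (edgeCount (symDiff S T)) ≡ odd (edgeCount S) xor odd (edgeCount T)
odd-edgeCount-symDiff {zero}  S T = refl
odd-edgeCount-symDiff {suc m} S T = begin
  odd (countTrue (λ j → S zero (suc j) xor T zero (suc j)) + edgeCount (symDiff S′ T′))
    ≡⟨ odd-+ (countTrue (λ j → S zero (suc j) xor T zero (suc j))) (edgeCount (symDiff S′ T′)) ⟩
  odd (countTrue (λ j → S zero (suc j) xor T zero (suc j))) xor odd (edgeCount (symDiff S′ T′))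
    ≡⟨ cong₂ _xor_ (odd-countTrue-xor (S zero ∘ suc) (T zero ∘ suc)) (odd-edgeCount-symDiff S′ T′) ⟩
  (odd (countTrue (S zero ∘ suc)) xor odd (countTrue (T zero ∘ suc))) xor (odd (edgeCount S′) xor odd (edgeCount T′))
    ≡⟨ xor-interchange (odd (countTrue (S zero ∘ suc))) (odd (countTrue (T zero ∘ suc)))
                       (odd (edgeCount S′)) (odd (edgeCount T′)) ⟩
  (odd (countTrue (S zero ∘ suc)) xor odd (edgeCount S′)) xor (odd (countTrue (T zero ∘ suc)) xor odd (edgeCount T′))
    ≡⟨ sym (cong₂ _xor_ (odd-+ (countTrue (S zero ∘ suc)) (edgeCount S′)) (odd-+ (countTrue (T zero ∘ suc)) (edgeCount T′))) ⟩
  odd (edgeCount S) xor odd (edgeCount T) ∎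
  where
  S′ T′ : EdgeSet m
  S′ i j = S (suc i) (suc j)
  T′ i j = T (suc i) (suc j)

handshake : ∀ {m} (S : EdgeSet m) → (∀ i j → S i j ≡ S j i) → (∀ i → S i i ≡ false) →
            ∑[ i < m ] degIn S i ≡ 2 * edgeCount S
handshake {zero}  S symmetric loopless = refl
handshake {suc m} S symmetric loopless = begin
  degIn S zero + ∑[ i < m ] (indicator (S (suc i) zero) + degIn S′ i)
    ≡⟨ cong₂ _+_ (cong (λ b → indicator b + r) (loopless zero))
                 (∑-distrib-+ (λ i → indicator (S (suc i) zero)) (degIn S′)) ⟩
  r + (∑[ i < m ] indicator (S (suc i) zero) + ∑[ i < m ] degIn S′ i)
    ≡⟨ cong (λ k → r + (k + ∑[ i < m ] degIn S′ i)) firstColumn ⟩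
  r + (r + ∑[ i < m ] degIn S′ i)
    ≡⟨ cong (λ k → r + (r + k)) (handshake S′ (λ i j → symmetric (suc i) (suc j)) (loopless ∘ suc)) ⟩
  r + (r + 2 * edgeCount S′)
    ≡⟨ double r (edgeCount S′) ⟩
  2 * (r + edgeCount S′) ∎
  where
  double : ∀ a b → a + (a + 2 * b) ≡ 2 * (a + b)
  double = solve-∀
  S′ : EdgeSet m
  S′ i j = S (suc i) (suc j)
  r : ℕ
  r = countTrue (S zero ∘ suc)
  firstColumn : ∑[ i < m ] indicator (S (suc i) zero) ≡ r
  firstColumn = trans (sym (countTrue≡∑ (λ i → S (suc i) zero))) (countTrue-cong (λ i → symmetric (suc i) zero))

odd-degIn-symDiff : ∀ {m} (S T : EdgeSet m) z → odd (degIn (symDiff S T) z) ≡ odd (degIn S z) xor odd (degIn T z)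
odd-degIn-symDiff S T z = odd-countTrue-xor (S z) (T z)

≟-sound : ∀ {m} {i j : Fin m} → does (i ≟ j) ≡ true → i ≡ j
≟-sound {i = i} {j} p with i ≟ j
≟-sound p  | yes i≡j = i≡j
≟-sound () | no _

≟-∧-sound : ∀ {m} {i x j y : Fin m} → does (i ≟ x) ∧ does (j ≟ y) ≡ true → i ≡ x × j ≡ y
≟-∧-sound {i = i} {x} p with i ≟ x
≟-∧-sound p  | yes i≡x = i≡x , ≟-sound p
≟-∧-sound () | no _

edge : ∀ {m} → Fin m → Fin m → EdgeSet m
edge x y i j = (does (i ≟ x) ∧ does (j ≟ y)) ∨ (does (i ≟ y) ∧ does (j ≟ x))

edge-sym : ∀ {m} (x y i j : Fin m) → edge x y i j ≡ edge x y j i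
edge-sym x y i j =
  trans (cong₂ _∨_ (∧-comm (does (i ≟ x)) _) (∧-comm (does (i ≟ y)) _)) (∨-comm (does (j ≟ y) ∧ _) _)

edge-true : ∀ {m} (x y i j : Fin m) → edge x y i j ≡ true → (i ≡ x × j ≡ y) ⊎ (i ≡ y × j ≡ x)
edge-true x y i j p with does (i ≟ x) ∧ does (j ≟ y) in forward
... | true  = inj₁ (≟-∧-sound forward)
... | false = inj₂ (≟-∧-sound p)

edge-loopless : ∀ {m} {x y : Fin m} → x ≢ y → ∀ i → edge x y i i ≡ false
edge-loopless {x = x} {y} x≢y i with edge x y i i in p
... | false = refl
... | true with edge-true x y i i p
...   | inj₁ (i≡x , i≡y) = ⊥-elim (x≢y (trans (sym i≡x) i≡y))
...   | inj₂ (i≡y , i≡x) = ⊥-elim (x≢y (trans (sym i≡x) i≡y))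

degIn-edge : ∀ {m} {x y : Fin m} → x ≢ y → ∀ z →
             degIn (edge x y) z ≡ indicator (does (z ≟ x)) + indicator (does (z ≟ y))
degIn-edge {m} {x} {y} x≢y z with z ≟ x | z ≟ y
... | yes refl | yes refl = ⊥-elim (x≢y refl)
... | yes refl | no _     = trans (countTrue-cong (λ j → ∨-identityʳ (does (j ≟ y)))) (countTrue-≟ y)
... | no _     | yes refl = countTrue-≟ x
... | no _     | no _     = countTrue-false {m}

odd-degIn-edge : ∀ {m} {x y : Fin m} → x ≢ y → ∀ z → odd (degIn (edge x y) z) ≡ does (z ≟ x) xor does (z ≟ y)
odd-degIn-edge {x = x} {y} x≢y z = begin
  odd (degIn (edge x y) z)
    ≡⟨ cong odd (degIn-edge x≢y z) ⟩
  odd (indicator (does (z ≟ x)) + indicator (does (z ≟ y)))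
    ≡⟨ odd-+ (indicator (does (z ≟ x))) (indicator (does (z ≟ y))) ⟩
  odd (indicator (does (z ≟ x))) xor odd (indicator (does (z ≟ y)))
    ≡⟨ cong₂ _xor_ (odd-indicator (does (z ≟ x))) (odd-indicator (does (z ≟ y))) ⟩
  does (z ≟ x) xor does (z ≟ y) ∎

edgeCount-edge : ∀ {m} {x y : Fin m} → x ≢ y → edgeCount (edge x y) ≡ 1
edgeCount-edge {m} {x} {y} x≢y = *-cancelˡ-≡ _ 1 2 (begin
  2 * edgeCount (edge x y)
    ≡⟨ sym (handshake (edge x y) (edge-sym x y) (edge-loopless x≢y)) ⟩
  ∑[ z < m ] degIn (edge x y) z
    ≡⟨ sum-cong-≗ (degIn-edge x≢y) ⟩
  ∑[ z < m ] (indicator (does (z ≟ x)) + indicator (does (z ≟ y)))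
    ≡⟨ ∑-distrib-+ (λ z → indicator (does (z ≟ x))) (λ z → indicator (does (z ≟ y))) ⟩
  ∑[ z < m ] indicator (does (z ≟ x)) + ∑[ z < m ] indicator (does (z ≟ y))
    ≡⟨ sym (cong₂ _+_ (countTrue≡∑ (λ z → does (z ≟ x))) (countTrue≡∑ (λ z → does (z ≟ y)))) ⟩
  countTrue (λ z → does (z ≟ x)) + countTrue (λ z → does (z ≟ y))
    ≡⟨ cong₂ _+_ (countTrue-≟ x) (countTrue-≟ y) ⟩
  2 ∎)

walkEdges : ∀ {m} {S : EdgeSet m} {x y} → Walk S x y → EdgeSet m
walkEdges here                = emptyES
walkEdges (step {u} {w} _ W) = symDiff (edge u w) (walkEdges W)

walk-⊆ : ∀ {m} {S T : EdgeSet m} → (∀ i j → S i j ≡ true → T i j ≡ true) → ∀ {x y} → Walk S x y → Walk T x y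
walk-⊆ S⊆T here         = here
walk-⊆ S⊆T (step uw W) = step (S⊆T _ _ uw) (walk-⊆ S⊆T W)

module _ (G : Graph) where

  adjacent-distinct : ∀ {x y} → Adj G x y ≡ true → x ≢ y
  adjacent-distinct {x} xy refl with () ← trans (sym xy) (irrefl G x)

  loopless : ∀ {S} → IsEdgeSetOf G S → ∀ i → S i i ≡ false
  loopless {S} (_ , S⊆G) i with S i i in p
  ... | false = refl
  ... | true with () ← trans (sym (S⊆G i i p)) (irrefl G i)

  IsEdgeSetOf-symDiff : ∀ {S T} → IsEdgeSetOf G S → IsEdgeSetOf G T → IsEdgeSetOf G (symDiff S T)
  IsEdgeSetOf-symDiff {S} {T} (S-sym , S⊆G) (T-sym , T⊆G) =
    (λ i j → cong₂ _xor_ (S-sym i j) (T-sym i j)) , ⊆G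
    where
    ⊆G : ∀ i j → S i j xor T i j ≡ true → Adj G i j ≡ true
    ⊆G i j p with S i j in Sij
    ... | true  = S⊆G i j Sij
    ... | false = T⊆G i j p

  IsEdgeSetOf-edge : ∀ {x y} → Adj G x y ≡ true → IsEdgeSetOf G (edge x y)
  IsEdgeSetOf-edge {x} {y} xy = edge-sym x y , ⊆G
    where
    ⊆G : ∀ i j → edge x y i j ≡ true → Adj G i j ≡ true
    ⊆G i j p with edge-true x y i j p
    ... | inj₁ (refl , refl) = xy
    ... | inj₂ (refl , refl) = trans (Adj-sym G y x) xy

  IsEdgeSetOf-walkEdges : ∀ {x y} (W : Walk (Adj G) x y) → IsEdgeSetOf G (walkEdges W)
  IsEdgeSetOf-walkEdges here         = (λ _ _ → refl) , (λ _ _ ())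
  IsEdgeSetOf-walkEdges (step uw W) =
    IsEdgeSetOf-symDiff (IsEdgeSetOf-edge uw) (IsEdgeSetOf-walkEdges W)

  odd-degIn-walkEdges : ∀ {x y} (W : Walk (Adj G) x y) → ∀ z →
                        odd (degIn (walkEdges W) z) ≡ does (z ≟ x) xor does (z ≟ y)
  odd-degIn-walkEdges {x} here z =
    trans (cong odd (countTrue-false {n G})) (sym (xor-same (does (z ≟ x))))
  odd-degIn-walkEdges (step {u} {w} {y} uw W) z = begin
    odd (degIn (walkEdges (step uw W)) z)
      ≡⟨ odd-degIn-symDiff (edge u w) (walkEdges W) z ⟩
    odd (degIn (edge u w) z) xor odd (degIn (walkEdges W) z)
      ≡⟨ cong₂ _xor_ (odd-degIn-edge (adjacent-distinct uw) z) (odd-degIn-walkEdges W z) ⟩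
    (does (z ≟ u) xor does (z ≟ w)) xor (does (z ≟ w) xor does (z ≟ y))
      ≡⟨ xor-cancel-middle (does (z ≟ u)) (does (z ≟ w)) (does (z ≟ y)) ⟩
    does (z ≟ u) xor does (z ≟ y) ∎

  cycle-through-edge : ∀ {x u w} (W₁ : Walk (Adj G) x u) (W₂ : Walk (Adj G) x w) → Adj G u w ≡ true →
                       IsCycle G (symDiff (walkEdges W₁) (symDiff (edge u w) (walkEdges W₂)))
  cycle-through-edge {x} {u} {w} W₁ W₂ uw =
    IsEdgeSetOf-symDiff (IsEdgeSetOf-walkEdges W₁)
      (IsEdgeSetOf-symDiff (IsEdgeSetOf-edge uw) (IsEdgeSetOf-walkEdges W₂)) ,
    λ z → even-if-not-odd _ (evenAt z)
    where
    evenAt : ∀ z → odd (degIn (symDiff (walkEdges W₁) (symDiff (edge u w) (walkEdges W₂))) z) ≡ false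
    evenAt z = begin
      odd (degIn (symDiff (walkEdges W₁) (symDiff (edge u w) (walkEdges W₂))) z)
        ≡⟨ odd-degIn-symDiff (walkEdges W₁) (symDiff (edge u w) (walkEdges W₂)) z ⟩
      odd (degIn (walkEdges W₁) z) xor odd (degIn (symDiff (edge u w) (walkEdges W₂)) z)
        ≡⟨ cong (odd (degIn (walkEdges W₁) z) xor_) (odd-degIn-symDiff (edge u w) (walkEdges W₂) z) ⟩
      odd (degIn (walkEdges W₁) z) xor (odd (degIn (edge u w) z) xor odd (degIn (walkEdges W₂) z))
        ≡⟨ cong₂ _xor_ (odd-degIn-walkEdges W₁ z)
                       (cong₂ _xor_ (odd-degIn-edge (adjacent-distinct uw) z)
                                    (trans (odd-degIn-walkEdges W₂ z) (xor-comm zx zw))) ⟩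
      (zx xor zu) xor ((zu xor zw) xor (zw xor zx))
        ≡⟨ cong ((zx xor zu) xor_) (xor-cancel-middle zu zw zx) ⟩
      (zx xor zu) xor (zu xor zx)
        ≡⟨ xor-cancel-middle zx zu zx ⟩
      zx xor zx
        ≡⟨ xor-same zx ⟩
      false ∎
      where
      zx zu zw : Bool
      zx = does (z ≟ x)
      zu = does (z ≟ u)
      zw = does (z ≟ w)

  bipartite-by-weight : (v : Fin (n G)) (ω : EdgeSet (n G) → Bool) →
                        (∀ S T → ω (symDiff S T) ≡ ω S xor ω T) →
                        (∀ S → IsCycle G S → ω S ≡ false) →
                        (∀ u w → u ≢ v → w ≢ v → Adj G u w ≡ true → ω (edge u w) ≡ true) →
                        (∀ u → Walk (Adj G) v u) → DeleteVertexBipartite G v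
  bipartite-by-weight v ω ω-symDiff ω-cycle ω-edge walk = colour , proper
    where
    colour : Fin (n G) → Bool
    colour u = ω (walkEdges (walk u))
    proper : ∀ u w → u ≢ v → w ≢ v → Adj G u w ≡ true → colour u ≢ colour w
    proper u w u≢v w≢v uw same = contradiction true≡false λ ()
      where
      true≡false : true ≡ false
      true≡false = begin
        true
          ≡⟨ sym (xor-true-xor (colour u)) ⟩
        colour u xor (true xor colour u)
          ≡⟨ cong (λ c → colour u xor (true xor c)) same ⟩
        colour u xor (true xor colour w)
          ≡⟨ cong (λ b → colour u xor (b xor colour w)) (sym (ω-edge u w u≢v w≢v uw)) ⟩
        colour u xor (ω (edge u w) xor colour w)
          ≡⟨ sym (trans (ω-symDiff _ _) (cong (colour u xor_) (ω-symDiff (edge u w) _))) ⟩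
        ω (symDiff (walkEdges (walk u)) (symDiff (edge u w) (walkEdges (walk w))))
          ≡⟨ ω-cycle _ (cycle-through-edge (walk u) (walk w) uw) ⟩
        false ∎

  edgeCount-hamiltonCircuit : ∀ {H} → IsHamiltonCircuit G H → edgeCount H ≡ n G
  edgeCount-hamiltonCircuit {H} (edgeSet@(H-sym , _) , degree≡2 , _) = *-cancelˡ-≡ _ _ 2 (begin
    2 * edgeCount H          ≡⟨ sym (handshake H H-sym (loopless edgeSet)) ⟩
    ∑[ z < n G ] degIn H z   ≡⟨ sum-cong-≗ degree≡2 ⟩
    ∑[ z < n G ] 2           ≡⟨ ∑-const (n G) 2 ⟩
    n G * 2                  ≡⟨ *-comm (n G) 2 ⟩
    2 * n G                  ∎)

  IsCycle-circuit : ∀ {C} → IsCircuitIn G C → IsCycle G C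
  IsCycle-circuit {C} (edgeSet , _ , degree , _) = edgeSet , even
    where
    even : ∀ z → 2 ∣ degIn C z
    even z with degree z
    ... | inj₁ degree≡0 = divides 0 degree≡0
    ... | inj₂ degree≡2 = divides 1 degree≡2

  hamiltonCircuit-of-circuit : CyclesSpannedByHamiltonCircuits G → ∀ {C} → IsCircuitIn G C →
                               ∃ (IsHamiltonCircuit G)
  hamiltonCircuit-of-circuit span {C} circuit@(_ , (i , j , Cij) , _) with span C (IsCycle-circuit circuit)
  ... | []    , []      , sum≡C with () ← trans (sum≡C i j) Cij
  ... | H ∷ _ , ham ∷ _ , _     = H , ham

  module _ (v a : Fin (n G)) where

    weight : EdgeSet (n G) → Bool
    weight S = odd (edgeCount S) xor (S v a ∧ odd (n G))

    weight-cong : ∀ {S T} → (∀ i j → S i j ≡ T i j) → weight S ≡ weight T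
    weight-cong S≗T = cong₂ (λ k b → odd k xor (b ∧ odd (n G))) (edgeCount-cong S≗T) (S≗T v a)

    weight-symDiff : ∀ S T → weight (symDiff S T) ≡ weight S xor weight T
    weight-symDiff S T = begin
      odd (edgeCount (symDiff S T)) xor ((S v a xor T v a) ∧ odd (n G))
        ≡⟨ cong₂ _xor_ (odd-edgeCount-symDiff S T) (∧-distribʳ-xor (odd (n G)) (S v a) (T v a)) ⟩
      (odd (edgeCount S) xor odd (edgeCount T)) xor ((S v a ∧ odd (n G)) xor (T v a ∧ odd (n G)))
        ≡⟨ xor-interchange (odd (edgeCount S)) (odd (edgeCount T)) (S v a ∧ odd (n G)) (T v a ∧ odd (n G)) ⟩
      weight S xor weight T ∎

    weight-edge : ∀ {u w} → u ≢ w → u ≢ v → w ≢ v → weight (edge u w) ≡ true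
    weight-edge {u} {w} u≢w u≢v w≢v
      rewrite edgeCount-edge u≢w | dec-false (v ≟ u) (u≢v ∘ sym) | dec-false (v ≟ w) (w≢v ∘ sym) = refl

    weight-hamiltonCircuit : Adj G v a ≡ true → deg G v ≡ 2 → ∀ {H} → IsHamiltonCircuit G H → weight H ≡ false
    weight-hamiltonCircuit va deg≡2 {H} ham@((_ , H⊆G) , degree≡2 , _) = begin
      odd (edgeCount H) xor (H v a ∧ odd (n G))  ≡⟨ cong₂ (λ k b → odd k xor (b ∧ odd (n G))) (edgeCount-hamiltonCircuit ham) Hva ⟩
      odd (n G) xor odd (n G)                    ≡⟨ xor-same (odd (n G)) ⟩
      false                                      ∎
      where
      Hva : H v a ≡ true
      Hva = countTrue-≡⇒⊇ (H⊆G v) (trans (degree≡2 v) (sym deg≡2)) a va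

    weight-hamiltonSpan : Adj G v a ≡ true → deg G v ≡ 2 → ∀ {S} → InHamiltonSpan G S → weight S ≡ false
    weight-hamiltonSpan va deg≡2 (Hs , hams , sum≡S) = trans (sym (weight-cong sum≡S)) (weight-sum Hs hams)
      where
      weight-sum : ∀ Hs → All (IsHamiltonCircuit G) Hs → weight (sumES Hs) ≡ false
      weight-sum []       []           = cong (λ k → odd k xor false) (edgeCount-empty {n G})
      weight-sum (H ∷ Hs) (ham ∷ hams) =
        trans (weight-symDiff H (sumES Hs))
              (cong₂ _xor_ (weight-hamiltonCircuit va deg≡2 ham) (weight-sum Hs hams))

DeleteVertexBipartite-dec : (G : Graph) (v : Fin (n G)) → Dec (DeleteVertexBipartite G v)
DeleteVertexBipartite-dec G v =
  map′ (λ (s , proper) → lookup s , proper) (λ (c , proper) → tabulate c , Proper-tabulate c proper)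
       (anySubset? (Proper? ∘ lookup))
  where
  Proper : (Fin (n G) → Bool) → Set
  Proper c = ∀ u w → u ≢ v → w ≢ v → Adj G u w ≡ true → c u ≢ c w
  Proper? : ∀ c → Dec (Proper c)
  Proper? c = all? λ u → all? λ w →
    ¬? (u ≟ v) →-dec ¬? (w ≟ v) →-dec (Adj G u w Bool.≟ true) →-dec ¬? (c u Bool.≟ c w)
  Proper-tabulate : ∀ c → Proper c → Proper (lookup (tabulate c))
  Proper-tabulate c proper u w u≢v w≢v uw same =
    proper u w u≢v w≢v uw (trans (sym (lookup∘tabulate c u)) (trans same (lookup∘tabulate c w)))

-- Since ¬ IsForest G only yields a circuit under a double negation, the
-- argument runs under decidable-stable.
lemma2 : (G : Graph) → ¬ IsForest G → ¬ IsCircuit G → CyclesSpannedByHamiltonCircuits G → (∃ λ u → deg G u ≡ 2) → ∀ v → deg G v ≡ 2 → DeleteVertexBipartite G v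
lemma2 G notForest _ span _ v deg≡2 =
  decidable-stable (DeleteVertexBipartite-dec G v) λ notBipartite →
    notForest λ (_ , circuit) → notBipartite (bipartite (hamiltonCircuit-of-circuit G span circuit))
  where
  neighbour : ∃ λ a → Adj G v a ≡ true
  neighbour = countTrue-nonzero (Adj G v) λ deg≡0 → contradiction (trans (sym deg≡2) deg≡0) λ ()
  bipartite : ∃ (IsHamiltonCircuit G) → DeleteVertexBipartite G v
  bipartite (_ , (_ , H⊆G) , _ , connected) with a , va ← neighbour =
    bipartite-by-weight G v (weight G v a) (weight-symDiff G v a)
      (λ S cycle → weight-hamiltonSpan G v a va deg≡2 (span S cycle))
      (λ u w u≢v w≢v uw → weight-edge G v a (adjacent-distinct G uw) u≢v w≢v)
      (λ u → walk-⊆ H⊆G (connected v u))
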